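{- Let $d_1,\dots,d_5,f$ be nonzero integers, $N=d_1d_2d_3d_4d_5f$, and $x_1,\dots,x_6,y_1,\dots,y_6$ integers. Put $u_1=d_1x_2+d_2x_3y_1$, $u_2=d_2x_4+d_4x_5y_2$, $v_1=d_1x_2y_3+d_2y_1$, $v_2=d_2x_4y_5+d_4y_2$, $T=d_3u_2+d_4d_5x_6y_3$, $S=d_2d_4d_5x_6y_1(x_3y_3-1)+d_3(u_1u_2-d_1d_4x_5)$. Assume the following congruences hold: $d_2d_4d_5x_6-Td_2x_3+Sx_1\equiv0 \pmod{d_1d_2d_3}$; $S\equiv0 \pmod{d_2d_3}$; $y_4(d_2d_4d_5x_6-Td_2x_3+Sx_1)+d_2d_3(d_2x_3-x_1u_1)\equiv0 \pmod{d_1d_2d_3d_4}$; $Sy_4-d_2d_3u_1\equiv0 \pmod{d_2d_3d_4}$; $Ty_4-d_2d_3\equiv0 \pmod{d_4}$; $y_5(d_2d_4d_5x_6-Td_2x_3+Sx_1)+v_2d_3(d_2x_3-x_1u_1)+d_1d_3d_4x_1\equiv0 \pmod{d_1d_2d_3d_4d_5}$; $d_1d_3d_4-d_3u_1v_2+Sy_5\equiv0 \pmod{d_2d_3d_4d_5}$; $Ty_5-d_3v_2\equiv0 \pmod{d_4d_5}$; $-(d_3u_2y_6+d_4d_5y_3)+Ty_6\equiv0 \pmod{d_4d_5f}$; $d_1d_3d_4x_5y_6-u_1(d_3u_2y_6+d_4d_5y_3)+d_4d_5v_1+Sy_6\equiv0 \pmod{d_2d_3d_4d_5f}$; $x_1\bigl(d_1d_3d_4x_5y_6-u_1(d_3u_2y_6+d_4d_5y_3)+d_4d_5v_1+Sy_6\bigr)+d_2d_4d_5x_3y_3+d_2d_4d_5(x_6y_6-1)+d_2d_3u_2x_3y_6-Td_2x_3y_6\equiv0\pmod{N}$.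 Assume moreover that $x_1,x_3,y_4$ are relatively prime to $N$, and let $\bar{x}_1,\bar{y}_4$ be integers with $x_1\bar{x}_1\equiv1$, $y_4\bar{y}_4\equiv1$ and $x_3y_3\equiv1$, all modulo $N$. Then $$d_2d_3u_1 \equiv d_2^2d_3\bar{x}_1x_3 \pmod{d_1d_2d_3},\qquad d_3u_2+d_4d_5x_6y_3 \equiv d_2d_3\bar{y}_4 \pmod{d_4},$$ $$d_3v_2 \equiv d_2d_3\bar{y}_4y_5 \pmod{d_4},\qquad d_2d_3d_4(d_5v_1+d_1d_3x_5y_6) \equiv d_2^2d_3d_4d_5\bar{x}_1 \pmod{d_2d_3}.$$
   Context: The assumed congruences are exactly the conditions under which the matrix $u_L w_0\,\mathrm{diag}(d_4d_5f,\frac{d_2d_3}{d_4},\frac{d_1}{d_2d_5},\frac{1}{d_1d_3f})u_R$ of the explicit Bruhat decomposition (in these parameters) is integral; they are the standing assumptions of this lemma in the paper. -}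

module Defs where

open import Data.Integer using (ℤ; _+_; _-_; _*_; -_; 1ℤ)
open import Data.Integer.Divisibility using (_∣_)

infix 4 _≡_[mod_]

_≡_[mod_] : ℤ → ℤ → ℤ → Set
a ≡ b [mod m ] = m ∣ (a - b)

u₁ : (d₁ d₂ x₂ x₃ y₁ : ℤ) → ℤ
u₁ d₁ d₂ x₂ x₃ y₁ = d₁ * x₂ + d₂ * x₃ * y₁

u₂ : (d₂ d₄ x₄ x₅ y₂ : ℤ) → ℤ
u₂ d₂ d₄ x₄ x₅ y₂ = d₂ * x₄ + d₄ * x₅ * y₂

v₁ : (d₁ d₂ x₂ y₁ y₃ : ℤ) → ℤ
v₁ d₁ d₂ x₂ y₁ y₃ = d₁ * x₂ * y₃ + d₂ * y₁

v₂ : (d₂ d₄ x₄ y₂ y₅ : ℤ) → ℤ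
v₂ d₂ d₄ x₄ y₂ y₅ = d₂ * x₄ * y₅ + d₄ * y₂

-- Only four of the eleven standing congruences are needed, and neither the nonvanishing
-- nor the coprimality hypotheses: cancelling the multiple y₄ A of the first one from the
-- third gives x₁ d₂ d₃ u₁ ≡ d₂² d₃ x₃ modulo d₁ d₂ d₃, and multiplying by the inverse
-- x̄₁ gives the first claim. Modulo d₄, T y₄ ≡ d₂ d₃ and T y₅ ≡ d₃ v₂, so multiplying
-- by ȳ₄ gives the second claim and substituting it gives the third. In the last claim
-- both sides are multiples of d₂ d₃.
module Submission where

open import Defs
open import Data.Integer using (ℤ; _+_; _-_; _*_; -_; 0ℤ; 1ℤ; _^_)
open import Data.Integer.Coprimality using (Coprime)
open import Data.Integer.Divisibility.Signed as Signed
  using (divides; ∣ᵤ⇒∣; ∣⇒∣ᵤ; ∣-refl; ∣-trans; ∣m∣n⇒∣m+n; ∣m∣n⇒∣m-n; ∣m⇒∣-m; ∣n⇒∣m*n; ∣m⇒∣m*n; *-monoˡ-∣)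
open import Data.Integer.Tactic.RingSolver using (solve)
open import Data.List using ([]; _∷_)
open import Data.Product using (_×_; _,_)
open import Level using (0ℓ)
open import Relation.Binary.Bundles using (Setoid)
open import Relation.Binary.PropositionalEquality using (_≡_; _≢_; refl; subst)
import Relation.Binary.Reasoning.Setoid as SetoidReasoning

-- a ≡ b [mod m] unfolds to divisibility of ∣ a - b ∣, from which Agda cannot recover a and b,
-- so the congruence lemmas take their terms (and the modulus) explicitly.
module Congruence (m : ℤ) where

  ∣-diff⇒≡-mod : ∀ a b {c} → m Signed.∣ c → c ≡ a - b → a ≡ b [mod m ]
  ∣-diff⇒≡-mod a b m∣c c≡a-b = ∣⇒∣ᵤ (subst (m Signed.∣_) c≡a-b m∣c)

  ≡-mod⇒∣-diff : ∀ a b → a ≡ b [mod m ] → m Signed.∣ a - b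
  ≡-mod⇒∣-diff a b = ∣ᵤ⇒∣ {m} {a - b}

  ≡⇒≡-mod : ∀ {a b} → a ≡ b → a ≡ b [mod m ]
  ≡⇒≡-mod {a} refl = ∣-diff⇒≡-mod a a (divides 0ℤ refl) (solve (a ∷ []))

  ≡-mod-sym : ∀ a b → a ≡ b [mod m ] → b ≡ a [mod m ]
  ≡-mod-sym a b a≡b = ∣-diff⇒≡-mod b a (∣m⇒∣-m (≡-mod⇒∣-diff a b a≡b)) (solve (a ∷ b ∷ []))

  ≡-mod-trans : ∀ a b c → a ≡ b [mod m ] → b ≡ c [mod m ] → a ≡ c [mod m ]
  ≡-mod-trans a b c a≡b b≡c = ∣-diff⇒≡-mod a c
    (∣m∣n⇒∣m+n (≡-mod⇒∣-diff a b a≡b) (≡-mod⇒∣-diff b c b≡c)) (solve (a ∷ b ∷ c ∷ []))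

  ≡-mod-*ˡ : ∀ c a b → a ≡ b [mod m ] → c * a ≡ c * b [mod m ]
  ≡-mod-*ˡ c a b a≡b = ∣-diff⇒≡-mod (c * a) (c * b)
    (∣n⇒∣m*n c (≡-mod⇒∣-diff a b a≡b)) (solve (a ∷ b ∷ c ∷ []))

  ≡-mod-*ʳ : ∀ c a b → a ≡ b [mod m ] → a * c ≡ b * c [mod m ]
  ≡-mod-*ʳ c a b a≡b = ∣-diff⇒≡-mod (a * c) (b * c)
    (∣m⇒∣m*n c (≡-mod⇒∣-diff a b a≡b)) (solve (a ∷ b ∷ c ∷ []))

  -≡0⇒≡-mod : ∀ a b → a - b ≡ 0ℤ [mod m ] → a ≡ b [mod m ]
  -≡0⇒≡-mod a b a-b≡0 =
    ∣-diff⇒≡-mod a b (≡-mod⇒∣-diff (a - b) 0ℤ a-b≡0) (solve (a ∷ b ∷ []))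

  ≡0-mod-cancel : ∀ c a e → c * a + e ≡ 0ℤ [mod m ] → a ≡ 0ℤ [mod m ] → e ≡ 0ℤ [mod m ]
  ≡0-mod-cancel c a e ca+e≡0 a≡0 =
    ∣-diff⇒≡-mod e 0ℤ
      (∣m∣n⇒∣m-n (≡-mod⇒∣-diff (c * a + e) 0ℤ ca+e≡0) (∣n⇒∣m*n c (≡-mod⇒∣-diff a 0ℤ a≡0)))
      (solve (c ∷ a ∷ e ∷ []))

  ≡-mod-weaken : ∀ n a b → m Signed.∣ n → a ≡ b [mod n ] → a ≡ b [mod m ]
  ≡-mod-weaken n a b m∣n a≡b = ∣⇒∣ᵤ (∣-trans m∣n (∣ᵤ⇒∣ {n} {a - b} a≡b))

  ∣⇒≡-mod : ∀ a b → m Signed.∣ a → m Signed.∣ b → a ≡ b [mod m ]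
  ∣⇒≡-mod a b m∣a m∣b = ∣-diff⇒≡-mod a b (∣m∣n⇒∣m-n m∣a m∣b) refl

  ≡-mod-setoid : Setoid 0ℓ 0ℓ
  ≡-mod-setoid = record
    { Carrier = ℤ
    ; _≈_ = _≡_[mod m ]
    ; isEquivalence = record
      { refl = λ {a} → ≡⇒≡-mod {a} refl
      ; sym = λ {a} {b} → ≡-mod-sym a b
      ; trans = λ {a} {b} {c} → ≡-mod-trans a b c
      }
    }

  ≡-mod-cancel-unit : ∀ x x̄ a b → x * x̄ ≡ 1ℤ [mod m ] → a * x ≡ b [mod m ] → a ≡ b * x̄ [mod m ]
  ≡-mod-cancel-unit x x̄ a b xx̄≡1 ax≡b = begin
    a            ≡⟨ solve (a ∷ []) ⟩
    a * 1ℤ       ≈⟨ ≡-mod-*ˡ a 1ℤ (x * x̄) (≡-mod-sym (x * x̄) 1ℤ xx̄≡1) ⟩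
    a * (x * x̄)  ≡⟨ solve (a ∷ x ∷ x̄ ∷ []) ⟩
    a * x * x̄    ≈⟨ ≡-mod-*ʳ x̄ (a * x) b ax≡b ⟩
    b * x̄        ∎
    where open SetoidReasoning ≡-mod-setoid

u₁-congruence : ∀ m A c d₂ d₃ u x₁ x̄₁ x₃ →
  A ≡ 0ℤ [mod m ] → c * A + d₂ * d₃ * (d₂ * x₃ - x₁ * u) ≡ 0ℤ [mod m ] → x₁ * x̄₁ ≡ 1ℤ [mod m ] →
  d₂ * d₃ * u ≡ d₂ ^ 2 * d₃ * x̄₁ * x₃ [mod m ]
u₁-congruence m A c d₂ d₃ u x₁ x̄₁ x₃ A≡0 cA+E≡0 x₁x̄₁≡1 = begin
  d₂ * d₃ * u
    ≈⟨ ≡-mod-cancel-unit x₁ x̄₁ (d₂ * d₃ * u) (d₂ * d₂ * d₃ * x₃) x₁x̄₁≡1 d₂d₃ux₁≡d₂²d₃x₃ ⟩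
  d₂ * d₂ * d₃ * x₃ * x̄₁         ≡⟨ solve (d₂ ∷ d₃ ∷ x̄₁ ∷ x₃ ∷ []) ⟩
  -- the ring solver does not recognise Data.Integer._^_, so the square is unfolded by hand
  d₂ * (d₂ * 1ℤ) * d₃ * x̄₁ * x₃  ≡⟨⟩
  d₂ ^ 2 * d₃ * x̄₁ * x₃          ∎
  where
  open Congruence m
  open SetoidReasoning ≡-mod-setoid
  d₂d₃ux₁≡d₂²d₃x₃ : d₂ * d₃ * u * x₁ ≡ d₂ * d₂ * d₃ * x₃ [mod m ]
  d₂d₃ux₁≡d₂²d₃x₃ = ≡-mod-sym (d₂ * d₂ * d₃ * x₃) (d₂ * d₃ * u * x₁)
    (-≡0⇒≡-mod (d₂ * d₂ * d₃ * x₃) (d₂ * d₃ * u * x₁) (begin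
      d₂ * d₂ * d₃ * x₃ - d₂ * d₃ * u * x₁  ≡⟨ solve (d₂ ∷ d₃ ∷ x₃ ∷ x₁ ∷ u ∷ []) ⟩
      d₂ * d₃ * (d₂ * x₃ - x₁ * u)          ≈⟨ ≡0-mod-cancel c A _ cA+E≡0 A≡0 ⟩
      0ℤ                                     ∎))

v₂-congruence : ∀ m T v d₂ d₃ ȳ₄ y₅ →
  T * y₅ - d₃ * v ≡ 0ℤ [mod m ] → T ≡ d₂ * d₃ * ȳ₄ [mod m ] → d₃ * v ≡ d₂ * d₃ * ȳ₄ * y₅ [mod m ]
v₂-congruence m T v d₂ d₃ ȳ₄ y₅ Ty₅-d₃v≡0 T≡d₂d₃ȳ₄ = begin
  d₃ * v              ≈⟨ -≡0⇒≡-mod (T * y₅) (d₃ * v) Ty₅-d₃v≡0 ⟨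
  T * y₅              ≈⟨ ≡-mod-*ʳ y₅ T (d₂ * d₃ * ȳ₄) T≡d₂d₃ȳ₄ ⟩
  d₂ * d₃ * ȳ₄ * y₅   ∎
  where
  open Congruence m
  open SetoidReasoning ≡-mod-setoid

lemma3p6 : (d₁ d₂ d₃ d₄ d₅ f : ℤ) → d₁ ≢ 0ℤ → d₂ ≢ 0ℤ → d₃ ≢ 0ℤ → d₄ ≢ 0ℤ → d₅ ≢ 0ℤ → f ≢ 0ℤ →
  (x₁ x₂ x₃ x₄ x₅ x₆ y₁ y₂ y₃ y₄ y₅ y₆ : ℤ) →
  let N = d₁ * d₂ * d₃ * d₄ * d₅ * f
      U₁ = u₁ d₁ d₂ x₂ x₃ y₁
      U₂ = u₂ d₂ d₄ x₄ x₅ y₂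
      V₁ = v₁ d₁ d₂ x₂ y₁ y₃
      V₂ = v₂ d₂ d₄ x₄ y₂ y₅
      T = d₃ * U₂ + d₄ * d₅ * x₆ * y₃
      S = d₂ * d₄ * d₅ * x₆ * y₁ * (x₃ * y₃ - 1ℤ) + d₃ * (U₁ * U₂ - d₁ * d₄ * x₅)
      A = d₂ * d₄ * d₅ * x₆ - T * d₂ * x₃ + S * x₁
      B = d₁ * d₃ * d₄ * x₅ * y₆ - U₁ * (d₃ * U₂ * y₆ + d₄ * d₅ * y₃) + d₄ * d₅ * V₁ + S * y₆
  in A ≡ 0ℤ [mod d₁ * d₂ * d₃ ] →
     S ≡ 0ℤ [mod d₂ * d₃ ] →
     y₄ * A + d₂ * d₃ * (d₂ * x₃ - x₁ * U₁) ≡ 0ℤ [mod d₁ * d₂ * d₃ * d₄ ] →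
     S * y₄ - d₂ * d₃ * U₁ ≡ 0ℤ [mod d₂ * d₃ * d₄ ] →
     T * y₄ - d₂ * d₃ ≡ 0ℤ [mod d₄ ] →
     y₅ * A + V₂ * d₃ * (d₂ * x₃ - x₁ * U₁) + d₁ * d₃ * d₄ * x₁ ≡ 0ℤ [mod d₁ * d₂ * d₃ * d₄ * d₅ ] →
     d₁ * d₃ * d₄ - d₃ * U₁ * V₂ + S * y₅ ≡ 0ℤ [mod d₂ * d₃ * d₄ * d₅ ] →
     T * y₅ - d₃ * V₂ ≡ 0ℤ [mod d₄ * d₅ ] →
     - (d₃ * U₂ * y₆ + d₄ * d₅ * y₃) + T * y₆ ≡ 0ℤ [mod d₄ * d₅ * f ] →
     B ≡ 0ℤ [mod d₂ * d₃ * d₄ * d₅ * f ] →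
     x₁ * B + d₂ * d₄ * d₅ * x₃ * y₃ + d₂ * d₄ * d₅ * (x₆ * y₆ - 1ℤ) + d₂ * d₃ * U₂ * x₃ * y₆ - T * d₂ * x₃ * y₆ ≡ 0ℤ [mod N ] →
     Coprime x₁ N → Coprime x₃ N → Coprime y₄ N →
     (x̄₁ ȳ₄ : ℤ) → x₁ * x̄₁ ≡ 1ℤ [mod N ] → y₄ * ȳ₄ ≡ 1ℤ [mod N ] → x₃ * y₃ ≡ 1ℤ [mod N ] →
     (d₂ * d₃ * U₁ ≡ d₂ ^ 2 * d₃ * x̄₁ * x₃ [mod d₁ * d₂ * d₃ ])
     × (d₃ * U₂ + d₄ * d₅ * x₆ * y₃ ≡ d₂ * d₃ * ȳ₄ [mod d₄ ])
     × (d₃ * V₂ ≡ d₂ * d₃ * ȳ₄ * y₅ [mod d₄ ])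
     × (d₂ * d₃ * d₄ * (d₅ * V₁ + d₁ * d₃ * x₅ * y₆) ≡ d₂ ^ 2 * d₃ * d₄ * d₅ * x̄₁ [mod d₂ * d₃ ])
lemma3p6 d₁ d₂ d₃ d₄ d₅ f _ _ _ _ _ _ x₁ x₂ x₃ x₄ x₅ x₆ y₁ y₂ y₃ y₄ y₅ y₆
         A≡0 _ y₄A+E≡0 _ Ty₄-d₂d₃≡0 _ _ Ty₅-d₃V₂≡0 _ _ _ _ _ _ x̄₁ ȳ₄ x₁x̄₁≡1 y₄ȳ₄≡1 _ =
    u₁-congruence (d₁ * d₂ * d₃) A y₄ d₂ d₃ U₁ x₁ x̄₁ x₃ A≡0
      (≡-mod-weaken (d₁ * d₂ * d₃) (d₁ * d₂ * d₃ * d₄) (y₄ * A + d₂ * d₃ * (d₂ * x₃ - x₁ * U₁)) 0ℤ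
        (∣m⇒∣m*n d₄ ∣-refl) y₄A+E≡0)
      (≡-mod-weaken (d₁ * d₂ * d₃) N (x₁ * x̄₁) 1ℤ d₁d₂d₃∣N x₁x̄₁≡1)
  , T≡d₂d₃ȳ₄
  , v₂-congruence d₄ T V₂ d₂ d₃ ȳ₄ y₅
      (≡-mod-weaken d₄ (d₄ * d₅) (T * y₅ - d₃ * V₂) 0ℤ (∣m⇒∣m*n d₅ ∣-refl) Ty₅-d₃V₂≡0) T≡d₂d₃ȳ₄
  , ∣⇒≡-mod (d₂ * d₃) (d₂ * d₃ * d₄ * (d₅ * V₁ + d₁ * d₃ * x₅ * y₆)) (d₂ ^ 2 * d₃ * d₄ * d₅ * x̄₁)
      (∣m⇒∣m*n (d₅ * V₁ + d₁ * d₃ * x₅ * y₆) (∣m⇒∣m*n d₄ ∣-refl))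
      (∣m⇒∣m*n x̄₁ (∣m⇒∣m*n d₅ (∣m⇒∣m*n d₄ d₂d₃∣d₂²d₃)))
  where
  open Congruence using (≡-mod-weaken; ≡-mod-cancel-unit; -≡0⇒≡-mod; ∣⇒≡-mod)

  N U₁ U₂ V₁ V₂ T S A : ℤ
  N = d₁ * d₂ * d₃ * d₄ * d₅ * f
  U₁ = u₁ d₁ d₂ x₂ x₃ y₁
  U₂ = u₂ d₂ d₄ x₄ x₅ y₂
  V₁ = v₁ d₁ d₂ x₂ y₁ y₃
  V₂ = v₂ d₂ d₄ x₄ y₂ y₅
  T = d₃ * U₂ + d₄ * d₅ * x₆ * y₃
  S = d₂ * d₄ * d₅ * x₆ * y₁ * (x₃ * y₃ - 1ℤ) + d₃ * (U₁ * U₂ - d₁ * d₄ * x₅)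
  A = d₂ * d₄ * d₅ * x₆ - T * d₂ * x₃ + S * x₁

  d₁d₂d₃∣N : d₁ * d₂ * d₃ Signed.∣ N
  d₁d₂d₃∣N = ∣m⇒∣m*n f (∣m⇒∣m*n d₅ (∣m⇒∣m*n d₄ ∣-refl))

  d₄∣N : d₄ Signed.∣ N
  d₄∣N = ∣m⇒∣m*n f (∣m⇒∣m*n d₅ (∣n⇒∣m*n (d₁ * d₂ * d₃) ∣-refl))

  d₂d₃∣d₂²d₃ : d₂ * d₃ Signed.∣ d₂ ^ 2 * d₃
  d₂d₃∣d₂²d₃ = *-monoˡ-∣ d₃ {d₂} {d₂ ^ 2} (∣m⇒∣m*n (d₂ * 1ℤ) ∣-refl)

  T≡d₂d₃ȳ₄ : T ≡ d₂ * d₃ * ȳ₄ [mod d₄ ]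
  T≡d₂d₃ȳ₄ = ≡-mod-cancel-unit d₄ y₄ ȳ₄ T (d₂ * d₃)
    (≡-mod-weaken d₄ N (y₄ * ȳ₄) 1ℤ d₄∣N y₄ȳ₄≡1) (-≡0⇒≡-mod d₄ (T * y₄) (d₂ * d₃) Ty₄-d₂d₃≡0)
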